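{- Index the coordinates of $\{0,1,2\}^m$ by $\{0,1,\dots,m-1\}$ and write a subset such as $\{0,1,3,4\}$ as $0134$. Then: (i) in $\{0,1,2\}^5$, the sets $0134, 0234, 1234$ form a type $11$ clash; (ii) in $\{0,1,2\}^5$, the sets $0124, 0134, 0234$ form a type $211$ clash; (iii) in $\{0,1,2\}^5$, the sets $0123, 0124, 0134$ form a type $1211$ clash; (iv) in $\{0,1,2\}^6$, the sets $0123, 0145, 2345$ form a type $1212$ clash.
   Context: For $v\in\{0,1,2\}^m$, the support of $v$ is the set of indices of its non-zero coordinates; $V_S$ is the set of vectors with support exactly $S$. Three vectors $v_1,v_2,v_3$ form a clash if there is no coordinate at which exactly one of them is non-zero and no coordinate at which their three values are pairwise distinct. For $t\in\{1,2\}^k$, a vector $v$ is of type $t$ if $v$ has at least $k$ non-zero coordinates and, for each $i\le k$, the $i$-th non-zero coordinate of $v$ (in increasing order of index) equals $t_i$. Sets $S_1,S_2,S_3$ of coordinates, each of size $w$, form a type $t$ clash if whenever $v_1\in V_{S_1}$, $v_2\in V_{S_2}$, $v_3\in V_{S_3}$ are all of type $t$, the triple $\{v_1,v_2,v_3\}$ is a clash. -}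

module Defs where

open import Data.Nat using (ℕ)
open import Data.Fin using (Fin; zero; suc)
open import Data.Fin.Subset using (Subset; _∈_; _∉_)
open import Data.List using (List; []; _∷_)
open import Data.List.Relation.Binary.Prefix.Heterogeneous using (Prefix)
open import Data.Product using (Σ; _×_; ∃)
open import Data.Empty using (⊥)
open import Relation.Nullary using (¬_)
open import Relation.Binary.PropositionalEquality using (_≡_; _≢_; refl)

Word : ℕ → Set
Word m = Fin m → Fin 3

-- non-zero values 1 and 2 (entries of a type t ∈ {1,2}^k)
data NZ : Set where
  one two : NZ

toF3 : NZ → Fin 3
toF3 one = suc zero
toF3 two = suc (suc zero)

IsNonzero : Fin 3 → Set
IsNonzero x = x ≢ zero

HasSupport : ∀ {m} → Word m → Subset m → Set
HasSupport {m} v S = (i : Fin m) → (i ∈ S → IsNonzero (v i)) × (i ∉ S → v i ≡ zero)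

nonzeros : ∀ {m} → Word m → List (Fin 3)
nonzeros {ℕ.zero} v = []
nonzeros {ℕ.suc m} v with v zero
... | zero = nonzeros (λ i → v (suc i))
... | x    = x ∷ nonzeros (λ i → v (suc i))

-- v is of type t : the first k non-zero coordinates of v are t_1,...,t_k
-- (prefix relation also forces at least k non-zero coordinates)
data Denotes : NZ → Fin 3 → Set where
  match : ∀ a → Denotes a (toF3 a)

OfType : ∀ {m} → List NZ → Word m → Set
OfType t v = Prefix Denotes t (nonzeros v)

ExactlyOneNonzero : Fin 3 → Fin 3 → Fin 3 → Set
ExactlyOneNonzero a b c =
    (IsNonzero a × b ≡ zero × c ≡ zero)
  Data.Sum.⊎ ((a ≡ zero × IsNonzero b × c ≡ zero)
  Data.Sum.⊎ (a ≡ zero × b ≡ zero × IsNonzero c))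
  where import Data.Sum

PairwiseDistinct : Fin 3 → Fin 3 → Fin 3 → Set
PairwiseDistinct a b c = a ≢ b × b ≢ c × a ≢ c

Clash : ∀ {m} → Word m → Word m → Word m → Set
Clash {m} v₁ v₂ v₃ =
    ¬ (Σ (Fin m) λ i → ExactlyOneNonzero (v₁ i) (v₂ i) (v₃ i))
  × ¬ (Σ (Fin m) λ i → PairwiseDistinct (v₁ i) (v₂ i) (v₃ i))

TypeClash : ∀ {m} → List NZ → Subset m → Subset m → Subset m → Set
TypeClash {m} t S₁ S₂ S₃ =
  (v₁ v₂ v₃ : Word m) →
  HasSupport v₁ S₁ → HasSupport v₂ S₂ → HasSupport v₃ S₃ →
  OfType t v₁ → OfType t v₂ → OfType t v₃ →
  Clash v₁ v₂ v₃

{-# OPTIONS --safe #-}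
-- Each claim is a finite statement about words in {0,1,2}^5 or {0,1,2}^6, so
-- it is settled by exhaustive search.  The search ranges over Vec (Fin 3) m,
-- where quantifiers are decidable; since support, type and clash only depend
-- on a word pointwise, lookup and tabulate carry the verdict over to all
-- functions Fin m → Fin 3.
module Submission where

open import Defs
open import Data.Bool using (true; false)
open import Data.List using (List; []; _∷_)
open import Data.Vec using (Vec; []; _∷_; lookup; tabulate)
open import Data.Product using (_×_; _,_; proj₁; proj₂)

open import Data.Nat using (ℕ)
open import Data.Fin using (Fin; zero; suc)
open import Data.Fin.Properties using (_≟_; all?; any?)
open import Data.Fin.Subset using (Subset)
open import Data.Fin.Subset.Properties using (_∈?_)
open import Data.List.Relation.Binary.Prefix.Heterogeneous using (Prefix)
open import Data.List.Relation.Binary.Prefix.Heterogeneous.Properties using (prefix?)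
open import Data.Unit using (tt)
open import Data.Vec.Properties using (lookup∘tabulate)
open import Function using (_∘_; _$_)
open import Relation.Nullary using (Dec; yes; no; ¬?)
open import Relation.Nullary.Decidable using (_×-dec_; _⊎-dec_; _→-dec_; map′; True; toWitness)
open import Relation.Binary.PropositionalEquality
  using (_≡_; _≗_; refl; sym; trans; cong; subst)

private
  variable
    m : ℕ
    t : List NZ
    S S₁ S₂ S₃ : Subset m
    v w v₁ v₂ v₃ w₁ w₂ w₃ : Word m

nonzeros-cong : v ≗ w → nonzeros v ≡ nonzeros w
nonzeros-cong {ℕ.zero}  v≗w = refl
nonzeros-cong {ℕ.suc m} {v} {w} v≗w with v zero | w zero | v≗w zero
... | zero  | .zero     | refl = nonzeros-cong (v≗w ∘ suc)
... | suc x | .(suc x)  | refl = cong (suc x ∷_) (nonzeros-cong (v≗w ∘ suc))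

hasSupport-cong : v ≗ w → HasSupport v S → HasSupport w S
hasSupport-cong v≗w supp i =
    (λ i∈S wi≡0 → proj₁ (supp i) i∈S (trans (v≗w i) wi≡0))
  , (λ i∉S → trans (sym (v≗w i)) (proj₂ (supp i) i∉S))

ofType-cong : v ≗ w → OfType t v → OfType t w
ofType-cong {t = t} v≗w = subst (Prefix Denotes t) (nonzeros-cong v≗w)

clash-cong : v₁ ≗ w₁ → v₂ ≗ w₂ → v₃ ≗ w₃ → Clash v₁ v₂ v₃ → Clash w₁ w₂ w₃
clash-cong {v₁ = v₁} {w₁} {v₂} {w₂} {v₃} {w₃} e₁ e₂ e₃ (¬exactlyOne , ¬distinct) =
    (λ (i , p) → ¬exactlyOne (i , subst-at ExactlyOneNonzero i p))
  , (λ (i , p) → ¬distinct (i , subst-at PairwiseDistinct i p))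
  where
  subst-at : (P : Fin 3 → Fin 3 → Fin 3 → Set) (i : Fin _) →
             P (w₁ i) (w₂ i) (w₃ i) → P (v₁ i) (v₂ i) (v₃ i)
  subst-at P i p rewrite e₁ i | e₂ i | e₃ i = p

isNonzero? : (x : Fin 3) → Dec (IsNonzero x)
isNonzero? x = ¬? (x ≟ zero)

denotes? : (a : NZ) (x : Fin 3) → Dec (Denotes a x)
denotes? one zero             = no λ ()
denotes? one (suc zero)       = yes (match one)
denotes? one (suc (suc zero)) = no λ ()
denotes? two zero             = no λ ()
denotes? two (suc zero)       = no λ ()
denotes? two (suc (suc zero)) = yes (match two)

hasSupport? : (v : Word m) (S : Subset m) → Dec (HasSupport v S)
hasSupport? v S = all? λ i →
  ((i ∈? S) →-dec isNonzero? (v i)) ×-dec (¬? (i ∈? S) →-dec (v i ≟ zero))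

ofType? : (t : List NZ) (v : Word m) → Dec (OfType t v)
ofType? t v = prefix? denotes? t (nonzeros v)

exactlyOneNonzero? : (a b c : Fin 3) → Dec (ExactlyOneNonzero a b c)
exactlyOneNonzero? a b c =
          (isNonzero? a ×-dec (b ≟ zero) ×-dec (c ≟ zero))
  ⊎-dec (((a ≟ zero) ×-dec isNonzero? b ×-dec (c ≟ zero))
  ⊎-dec ((a ≟ zero) ×-dec (b ≟ zero) ×-dec isNonzero? c))

pairwiseDistinct? : (a b c : Fin 3) → Dec (PairwiseDistinct a b c)
pairwiseDistinct? a b c = ¬? (a ≟ b) ×-dec ¬? (b ≟ c) ×-dec ¬? (a ≟ c)

clash? : (v₁ v₂ v₃ : Word m) → Dec (Clash v₁ v₂ v₃)
clash? v₁ v₂ v₃ =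
          ¬? (any? λ i → exactlyOneNonzero? (v₁ i) (v₂ i) (v₃ i))
  ×-dec ¬? (any? λ i → pairwiseDistinct? (v₁ i) (v₂ i) (v₃ i))

InClass : List NZ → Subset m → Word m → Set
InClass t S v = HasSupport v S × OfType t v

inClass? : (t : List NZ) (S : Subset m) (v : Word m) → Dec (InClass t S v)
inClass? t S v = hasSupport? v S ×-dec ofType? t v

inClass-cong : v ≗ w → InClass t S v → InClass t S w
inClass-cong v≗w (supp , type) = hasSupport-cong v≗w supp , ofType-cong v≗w type

∀-Vec? : ∀ {k n} {P : Vec (Fin k) n → Set} → (∀ xs → Dec (P xs)) → Dec (∀ xs → P xs)
∀-Vec? {n = ℕ.zero}  P? = map′ (λ p → λ { [] → p }) (_$ []) (P? [])
∀-Vec? {n = ℕ.suc n} P? =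
  map′ (λ p → λ { (x ∷ xs) → p x xs }) (λ p x xs → p (x ∷ xs))
       (all? λ x → ∀-Vec? λ xs → P? (x ∷ xs))

TypeClashOnVecs : List NZ → Subset m → Subset m → Subset m → Set
TypeClashOnVecs {m} t S₁ S₂ S₃ =
  (xs₁ : Vec (Fin 3) m) → InClass t S₁ (lookup xs₁) →
  (xs₂ : Vec (Fin 3) m) → InClass t S₂ (lookup xs₂) →
  (xs₃ : Vec (Fin 3) m) → InClass t S₃ (lookup xs₃) →
  Clash (lookup xs₁) (lookup xs₂) (lookup xs₃)

typeClashOnVecs? : (t : List NZ) (S₁ S₂ S₃ : Subset m) → Dec (TypeClashOnVecs t S₁ S₂ S₃)
typeClashOnVecs? t S₁ S₂ S₃ =
  ∀-Vec? λ xs₁ → inClass? t S₁ (lookup xs₁) →-dec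
  ∀-Vec? λ xs₂ → inClass? t S₂ (lookup xs₂) →-dec
  ∀-Vec? λ xs₃ → inClass? t S₃ (lookup xs₃) →-dec
  clash? (lookup xs₁) (lookup xs₂) (lookup xs₃)

typeClashOnVecs⇒typeClash : TypeClashOnVecs t S₁ S₂ S₃ → TypeClash t S₁ S₂ S₃
typeClashOnVecs⇒typeClash onVecs v₁ v₂ v₃ s₁ s₂ s₃ o₁ o₂ o₃ =
  clash-cong (lookup∘tabulate v₁) (lookup∘tabulate v₂) (lookup∘tabulate v₃)
    (onVecs (tabulate v₁) (inClass-cong (sym ∘ lookup∘tabulate v₁) (s₁ , o₁))
            (tabulate v₂) (inClass-cong (sym ∘ lookup∘tabulate v₂) (s₂ , o₂))
            (tabulate v₃) (inClass-cong (sym ∘ lookup∘tabulate v₃) (s₃ , o₃)))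

typeClash-by-decision : (t : List NZ) (S₁ S₂ S₃ : Subset m) →
  True (typeClashOnVecs? t S₁ S₂ S₃) → TypeClash t S₁ S₂ S₃
typeClash-by-decision t S₁ S₂ S₃ = typeClashOnVecs⇒typeClash ∘ toWitness

theorem3 : TypeClash (one ∷ one ∷ [])
    (true ∷ true ∷ false ∷ true ∷ true ∷ [])
    (true ∷ false ∷ true ∷ true ∷ true ∷ [])
    (false ∷ true ∷ true ∷ true ∷ true ∷ [])
    × TypeClash (two ∷ one ∷ one ∷ [])
    (true ∷ true ∷ true ∷ false ∷ true ∷ [])
    (true ∷ true ∷ false ∷ true ∷ true ∷ [])
    (true ∷ false ∷ true ∷ true ∷ true ∷ [])
    × TypeClash (one ∷ two ∷ one ∷ one ∷ [])
    (true ∷ true ∷ true ∷ true ∷ false ∷ [])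
    (true ∷ true ∷ true ∷ false ∷ true ∷ [])
    (true ∷ true ∷ false ∷ true ∷ true ∷ [])
    × TypeClash (one ∷ two ∷ one ∷ two ∷ [])
    (true ∷ true ∷ true ∷ true ∷ false ∷ false ∷ [])
    (true ∷ true ∷ false ∷ false ∷ true ∷ true ∷ [])
    (false ∷ false ∷ true ∷ true ∷ true ∷ true ∷ [])
theorem3 =
    typeClash-by-decision _ _ _ _ tt
  , typeClash-by-decision _ _ _ _ tt
  , typeClash-by-decision _ _ _ _ tt
  , typeClash-by-decision _ _ _ _ tt
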